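{- Let $\Delta$ be a well-formed linear context. If $\Delta \Rightarrow \Delta'$, where $\Rightarrow$ is linear context advancement, then $\Delta'$ is well-formed.
   Context: Session types are generated by the grammar $T ::= \,!\beta.T \mid ?\beta.T \mid \oplus\{\ell_i : T_i\}_{i\in I} \mid \&\{\ell_i:T_i\}_{i\in I} \mid \mathsf{end} \mid t \mid \mu t.T$, where $\beta$ ranges over a set of base types, $\ell_i$ over labels and $t$ over type variables. Duality $\overline{T}$ is defined by $\overline{\mathsf{end}}=\mathsf{end}$, $\overline{!\beta.T} = ?\beta.\overline{T}$, $\overline{?\beta.T} = !\beta.\overline{T}$, $\overline{t}=t$, $\overline{\mu t.T} = \mu t.\overline{T}$, $\overline{\oplus\{\ell_i:T_i\}_{i\in I}} = \&\{\ell_i:\overline{T_i}\}_{i\in I}$, $\overline{\&\{\ell_i:T_i\}_{i\in I}} = \oplus\{\ell_i:\overline{T_i}\}_{i\in I}$; in particular $\overline{\overline{T}} = T$. Each session channel $s$ has two distinct endpoints, written $s$ and $\overline{s}$. A linear context $\Delta$ is a finite set of assignments with pairwise distinct subjects, each of the form $k : T$ (with $k$ a session endpoint or a variable) or $\kappa : (c, T)$ with $\kappa$ a session endpoint ($s$ or $\overline{s}$), $c \in \mathbb{N}$ a session-state counter and $T$ a session type; $\Delta, \Delta'$ denotes disjoint union, and $\mathrm{dom}(\Delta)$ is the set of subjects. A linear context $\Delta$ is well-formed if whenever $\overline{s} : (c, T) \in \Delta$, then either $s : (c, \overline{T}) \in \Delta$ or $s \notin \mathrm{dom}(\Delta)$.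 Linear context advancement $\Delta \Rightarrow \Delta'$ is the relation defined by the following cases (for any linear context $\Delta$): (1) $\Delta, \overline{s} : (c, !\beta.T_1), s : (c, ?\beta.T_2) \Rightarrow \Delta, \overline{s} : (c+1, T_1), s : (c+1, T_2)$; (2) $\Delta, \overline{s} : (c, \oplus\{\ell_i:T_i\}_{i\in I}), s : (c, \&\{\ell_i:T'_i\}_{i\in I}) \Rightarrow \Delta, \overline{s} : (c+1, T_k), s : (c+1, T'_k)$ for $k \in I$; (3) $\Delta, s : (c, !\beta.T_1), \overline{s} : (c, ?\beta.T_2) \Rightarrow \Delta, s : (c+1, T_1), \overline{s} : (c+1, T_2)$; (4) $\Delta, \{s_i : (c_i, T_i)\}_{i \in I} \Rightarrow \Delta$, i.e. entries for endpoints of the form $s$ (not of the form $\overline{s}$) may be dropped. -}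

module Defs where

open import Data.Nat using (ℕ; suc)
open import Data.Fin using (Fin)
open import Data.Product using (Σ; ∃; _×_; _,_)
open import Data.Sum using (_⊎_)
open import Data.List using (List; []; _∷_; _++_; map)
open import Data.List.Membership.Propositional using (_∈_)
open import Data.List.Relation.Unary.All using (All)
open import Data.List.Relation.Unary.Unique.Propositional using (Unique)
open import Data.List.Relation.Binary.Permutation.Propositional using (_↭_)
open import Relation.Nullary using (¬_)
open import Relation.Binary.PropositionalEquality using (_≡_)

-- A branching {ℓ_i : T_i}_{i∈I} is given by a finite index set I = Fin n,
-- a labelling ℓ : Fin n → L and a family of continuations T : Fin n → SType.
data SType (B L V : Set) : Set where
  send   : B → SType B L V → SType B L V
  recv   : B → SType B L V → SType B L V
  select : (n : ℕ) → (Fin n → L) → (Fin n → SType B L V) → SType B L V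
  branch : (n : ℕ) → (Fin n → L) → (Fin n → SType B L V) → SType B L V
  end    : SType B L V
  tvar   : V → SType B L V
  rec    : V → SType B L V → SType B L V

module _ {B L V : Set} where
  dual : SType B L V → SType B L V
  dual (send b T)       = recv b (dual T)
  dual (recv b T)       = send b (dual T)
  dual (select n ℓ T)   = branch n ℓ (λ i → dual (T i))
  dual (branch n ℓ T)   = select n ℓ (λ i → dual (T i))
  dual end              = end
  dual (tvar t)         = tvar t
  dual (rec t T)        = rec t (dual T)

-- Endpoint polarity: pos is s, neg is s̄.
data Pol : Set where
  pos neg : Pol

data Subj (S X : Set) : Set where
  ep  : S → Pol → Subj S X
  var : X → Subj S X

-- Assignments:  k : T   (plain)   or   κ : (c, T)   (with κ an endpoint).
data Entry (B L V S X : Set) : Set where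
  plain : Subj S X → SType B L V → Entry B L V S X
  state : S → Pol → ℕ → SType B L V → Entry B L V S X

module _ {B L V S X : Set} where
  subj : Entry B L V S X → Subj S X
  subj (plain k T)     = k
  subj (state s p c T) = ep s p

  -- A linear context: a finite list of assignments with pairwise distinct subjects
  -- (considered up to permutation, see advancement below).
  record LinCtx : Set where
    constructor ctx
    field
      entries  : List (Entry B L V S X)
      distinct : Unique (map subj entries)
  open LinCtx public

  dom : LinCtx → List (Subj S X)
  dom Δ = map subj (entries Δ)

  WellFormed : LinCtx → Set
  WellFormed Δ = ∀ (s : S) (c : ℕ) (T : SType B L V) →
    state s neg c T ∈ entries Δ →
    (state s pos c (dual T) ∈ entries Δ) ⊎ ¬ (ep s pos ∈ dom Δ)

  data PosState : Entry B L V S X → Set where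
    posState : ∀ s c T → PosState (state s pos c T)

  -- Linear context advancement Δ ⇒ Δ'.  Disjoint union "Γ, e₁, e₂" is the
  -- concatenation Γ ++ e₁ ∷ e₂ ∷ [] up to permutation (contexts are sets).
  data _⇒_ (Δ Δ' : LinCtx) : Set where
    adv-out : ∀ (Γ : List (Entry B L V S X)) s c β T₁ T₂ →
      entries Δ  ↭ Γ ++ state s neg c (send β T₁) ∷ state s pos c (recv β T₂) ∷ [] →
      entries Δ' ↭ Γ ++ state s neg (suc c) T₁ ∷ state s pos (suc c) T₂ ∷ [] →
      Δ ⇒ Δ'
    adv-sel : ∀ (Γ : List (Entry B L V S X)) s c (n : ℕ) (ℓ : Fin n → L)
                (T T' : Fin n → SType B L V) (k : Fin n) →
      entries Δ  ↭ Γ ++ state s neg c (select n ℓ T) ∷ state s pos c (branch n ℓ T') ∷ [] →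
      entries Δ' ↭ Γ ++ state s neg (suc c) (T k) ∷ state s pos (suc c) (T' k) ∷ [] →
      Δ ⇒ Δ'
    adv-in : ∀ (Γ : List (Entry B L V S X)) s c β T₁ T₂ →
      entries Δ  ↭ Γ ++ state s pos c (send β T₁) ∷ state s neg c (recv β T₂) ∷ [] →
      entries Δ' ↭ Γ ++ state s pos (suc c) T₁ ∷ state s neg (suc c) T₂ ∷ [] →
      Δ ⇒ Δ'
    adv-drop : ∀ (Γ Θ : List (Entry B L V S X)) → All PosState Θ →
      entries Δ  ↭ Γ ++ Θ →
      entries Δ' ↭ Γ →
      Δ ⇒ Δ'

-- Advancement touches a context in one of two ways.  Dropping entries keeps it
-- well-formed, because subjects are distinct: a dropped partner s of a remaining s̄
-- is no longer in the domain.  A communication step replaces both endpoints of one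
-- session; well-formedness of Δ forces their old types to be dual, hence the new
-- ones are dual too, and the rest of the context is unaffected since no other
-- entry can mention s or s̄.
module Submission where

open import Defs
open import Function using (_∘_)
open import Data.Nat using (ℕ)
open import Data.Sum using (_⊎_; inj₁; inj₂; [_,_]′)
import Data.Sum as Sum
open import Data.Empty using (⊥; ⊥-elim)
open import Data.List using (List; []; _∷_; _++_; map)
open import Data.List.Properties using (map-++)
open import Data.List.Membership.Propositional using (_∈_)
open import Data.List.Membership.Propositional.Properties using (∈-map⁺; ∈-++⁺ˡ; ∈-++⁺ʳ; ∈-++⁻)
open import Data.List.Relation.Unary.Any using (here; there)
import Data.List.Relation.Unary.All as All
open import Data.List.Relation.Unary.AllPairs using (_∷_)
open import Data.List.Relation.Unary.Unique.Propositional using (Unique)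
open import Data.List.Relation.Binary.Permutation.Propositional using (_↭_; ↭-sym; ↭-trans; ↭-refl; ↭-swap; ↭⇒↭ₛ)
open import Data.List.Relation.Binary.Permutation.Propositional.Properties using (∈-resp-↭; map⁺; ++⁺ˡ)
open import Data.List.Relation.Binary.Permutation.Setoid.Properties using (Unique-resp-↭)
open import Relation.Nullary using (¬_)
open import Relation.Binary.PropositionalEquality using (_≡_; refl; subst; sym; setoid)

module _ {A : Set} where

  Unique-++⇒disjoint : ∀ xs {ys : List A} {x} → Unique (xs ++ ys) → x ∈ xs → x ∈ ys → ⊥
  Unique-++⇒disjoint (_ ∷ xs) (x∉ ∷ _) (here refl) x∈ys = All.lookup x∉ (∈-++⁺ʳ xs x∈ys) refl
  Unique-++⇒disjoint (_ ∷ xs) (_ ∷ u)  (there x∈xs) x∈ys = Unique-++⇒disjoint xs u x∈xs x∈ys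

  Unique-map⇒injectiveOn : ∀ {B : Set} {f : A → B} {xs x y} →
    Unique (map f xs) → x ∈ xs → y ∈ xs → f x ≡ f y → x ≡ y
  Unique-map⇒injectiveOn _            (here refl) (here refl) _   = refl
  Unique-map⇒injectiveOn (fx∉ ∷ _)    (here refl) (there y∈)  fxy = ⊥-elim (All.lookup fx∉ (∈-map⁺ _ y∈) fxy)
  Unique-map⇒injectiveOn (fy∉ ∷ _)    (there x∈)  (here refl) fxy = ⊥-elim (All.lookup fy∉ (∈-map⁺ _ x∈) (sym fxy))
  Unique-map⇒injectiveOn (_ ∷ u)      (there x∈)  (there y∈)  fxy = Unique-map⇒injectiveOn u x∈ y∈ fxy

  ↭-swap-last-two : ∀ (Γ : List A) {x y} → Γ ++ x ∷ y ∷ [] ↭ Γ ++ y ∷ x ∷ []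
  ↭-swap-last-two Γ = ++⁺ˡ Γ (↭-swap _ _ ↭-refl)

module _ {B L V S X : Set} where

  private
    Ent = Entry B L V S X

  subjects : List Ent → List (Subj S X)
  subjects = map subj

  WellFormedEntries : List Ent → Set
  WellFormedEntries E = ∀ s c T → state s neg c T ∈ E →
    state s pos c (dual T) ∈ E ⊎ ¬ (ep s pos ∈ subjects E)

  Paired : List Ent → Set
  Paired ys = ∀ s c T → state s neg c T ∈ ys → state s pos c (dual T) ∈ ys

  NegEndpointClosed : List Ent → Set
  NegEndpointClosed ys = ∀ s → ep s pos ∈ subjects ys → ep s neg ∈ subjects ys

  session : S → ℕ → SType B L V → List Ent
  session s c T = state s neg c T ∷ state s pos c (dual T) ∷ []

  session-paired : ∀ {s c T} → Paired (session s c T)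
  session-paired _ _ _ (here refl)       = there (here refl)
  session-paired _ _ _ (there (there ()))

  session-negEndpointClosed : ∀ {s c T} → NegEndpointClosed (session s c T)
  session-negEndpointClosed _ (there (here refl)) = here refl
  session-negEndpointClosed _ (there (there ()))

  subjects-++⁺ˡ : ∀ Γ {Θ k} → k ∈ subjects Γ → k ∈ subjects (Γ ++ Θ)
  subjects-++⁺ˡ Γ {Θ} k∈ = subst (_ ∈_) (sym (map-++ subj Γ Θ)) (∈-++⁺ˡ k∈)

  subjects-++⁻ : ∀ Γ {Θ k} → k ∈ subjects (Γ ++ Θ) → k ∈ subjects Γ ⊎ k ∈ subjects Θ
  subjects-++⁻ Γ {Θ} k∈ = ∈-++⁻ (subjects Γ) (subst (_ ∈_) (map-++ subj Γ Θ) k∈)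

  subjects-disjoint : ∀ Γ {Θ k} → Unique (subjects (Γ ++ Θ)) →
    k ∈ subjects Γ → k ∈ subjects Θ → ⊥
  subjects-disjoint Γ {Θ} u = Unique-++⇒disjoint (subjects Γ) (subst Unique (map-++ subj Γ Θ) u)

  Unique-subjects-resp-↭ : ∀ {E E'} → E ↭ E' → Unique (subjects E) → Unique (subjects E')
  Unique-subjects-resp-↭ p = Unique-resp-↭ (setoid _) (↭⇒↭ₛ (map⁺ subj p))

  wellFormed-resp-↭ : ∀ {E E'} → E ↭ E' → WellFormedEntries E → WellFormedEntries E'
  wellFormed-resp-↭ p wf s c T s̄∈ =
    Sum.map (∈-resp-↭ p) (_∘ ∈-resp-↭ (map⁺ subj (↭-sym p))) (wf s c T (∈-resp-↭ (↭-sym p) s̄∈))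

  wellFormed⇒dual : ∀ {E s c T U} → Unique (subjects E) → WellFormedEntries E →
    state s neg c T ∈ E → state s pos c U ∈ E → U ≡ dual T
  wellFormed⇒dual u wf s̄∈ s∈ with wf _ _ _ s̄∈
  ... | inj₂ s∉ = ⊥-elim (s∉ (∈-map⁺ subj s∈))
  ... | inj₁ s∈′ with Unique-map⇒injectiveOn u s∈ s∈′ refl
  ...   | refl = refl

  wellFormed-++⁻ˡ : ∀ Γ {Θ} → Unique (subjects (Γ ++ Θ)) →
    WellFormedEntries (Γ ++ Θ) → WellFormedEntries Γ
  wellFormed-++⁻ˡ Γ u wf s c T s̄∈ with wf s c T (∈-++⁺ˡ s̄∈)
  ... | inj₂ s∉ = inj₂ (s∉ ∘ subjects-++⁺ˡ Γ)
  ... | inj₁ s∈ with ∈-++⁻ Γ s∈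
  ...   | inj₁ s∈Γ = inj₁ s∈Γ
  ...   | inj₂ s∈Θ = inj₂ λ s∈Γ → subjects-disjoint Γ u s∈Γ (∈-map⁺ subj s∈Θ)

  wellFormed-++ : ∀ Γ {Θ} → Unique (subjects (Γ ++ Θ)) → WellFormedEntries Γ →
    Paired Θ → NegEndpointClosed Θ → WellFormedEntries (Γ ++ Θ)
  wellFormed-++ Γ u wf paired closed s c T s̄∈ with ∈-++⁻ Γ s̄∈
  ... | inj₂ s̄∈Θ = inj₁ (∈-++⁺ʳ Γ (paired s c T s̄∈Θ))
  ... | inj₁ s̄∈Γ with wf s c T s̄∈Γ
  ...   | inj₁ s∈Γ = inj₁ (∈-++⁺ˡ s∈Γ)
  ...   | inj₂ s∉Γ = inj₂ λ s∈ → [ s∉Γ , s∉Θ ]′ (subjects-++⁻ Γ s∈)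
    where
    s∉Θ : ¬ (ep s pos ∈ subjects _)
    s∉Θ s∈Θ = subjects-disjoint Γ u (∈-map⁺ subj s̄∈Γ) (closed s s∈Θ)

  wellFormed-remainder : ∀ Γ {Θ E} → E ↭ Γ ++ Θ → Unique (subjects E) →
    WellFormedEntries E → WellFormedEntries Γ
  wellFormed-remainder Γ p u wf =
    wellFormed-++⁻ˡ Γ (Unique-subjects-resp-↭ p u) (wellFormed-resp-↭ p wf)

  wellFormed-session : ∀ Γ {s c T E} → E ↭ Γ ++ session s c T → Unique (subjects E) →
    WellFormedEntries Γ → WellFormedEntries E
  wellFormed-session Γ {s} {c} {T} p u wf = wellFormed-resp-↭ (↭-sym p)
    (wellFormed-++ Γ (Unique-subjects-resp-↭ p u) wf
      (session-paired {s = s} {c} {T}) (session-negEndpointClosed {s = s} {c} {T}))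

  wellFormed⇒dual-session : ∀ Γ {E s c T U} →
    E ↭ Γ ++ state s neg c T ∷ state s pos c U ∷ [] → Unique (subjects E) →
    WellFormedEntries E → U ≡ dual T
  wellFormed⇒dual-session Γ p u wf =
    wellFormed⇒dual u wf (∈-resp-↭ (↭-sym p) (∈-++⁺ʳ Γ (here refl)))
                         (∈-resp-↭ (↭-sym p) (∈-++⁺ʳ Γ (there (here refl))))

mainTheorem1 : ∀ {B L V S X : Set} (Δ Δ' : LinCtx {B} {L} {V} {S} {X}) →
    WellFormed Δ → Δ ⇒ Δ' → WellFormed Δ'
mainTheorem1 (ctx E u) (ctx E' u') wf (adv-out Γ s c β T₁ T₂ p p')
  with wellFormed⇒dual-session Γ p u wf
... | refl = wellFormed-session Γ p' u' (wellFormed-remainder Γ p u wf)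
mainTheorem1 (ctx E u) (ctx E' u') wf (adv-sel Γ s c n ℓ T T' k p p')
  with wellFormed⇒dual-session Γ p u wf
... | refl = wellFormed-session Γ p' u' (wellFormed-remainder Γ p u wf)
mainTheorem1 (ctx E u) (ctx E' u') wf (adv-in Γ s c β T₁ T₂ p p')
  with wellFormed⇒dual-session Γ (↭-trans p (↭-swap-last-two Γ)) u wf
... | refl = wellFormed-session Γ (↭-trans p' (↭-swap-last-two Γ)) u'
               (wellFormed-remainder Γ p u wf)
-- Any dropped part Θ preserves well-formedness.
mainTheorem1 (ctx E u) (ctx E' u') wf (adv-drop Γ Θ _ p p') =
  wellFormed-resp-↭ (↭-sym p') (wellFormed-remainder Γ p u wf)
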